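{- Let $E$ be a finite set and $\tau:2^{E}\to2^{E}$ an operator satisfying (C1) $X\subseteq\tau(X)$ for all $X\subseteq E$, and (C22) for all $F\subseteq G\subseteq E$ with $G\subseteq\tau(F)$, $\tau(G)=\tau(F)$ (a violator space), and suppose $(E,\tau)$ is uniquely generated. Then for all $X,Y\subseteq E$ with $\tau(X)=\tau(Y)$ we have $\tau(X\cap Y)=\tau(X\cup Y)=\tau(X)$; that is, each equivalence class $\{Z\subseteq E:\tau(Z)=\tau(X)\}$ is closed under intersection and union.
   Context: A generator of $X$ is any $B\subseteq E$ with $\tau(B)=\tau(X)$; a basis of $X$ is an inclusion-minimal generator of $X$; $(E,\tau)$ is uniquely generated if every $X\subseteq E$ has exactly one basis. -}

module Defs where

open import Data.Nat using (ℕ)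
open import Data.Fin.Subset using (Subset; _⊆_; _⊂_)
open import Data.Product using (_×_; ∃)
open import Relation.Binary.PropositionalEquality using (_≡_)
open import Relation.Nullary using (¬_)

-- The ground set E is Fin n; subsets of E are Subset n; an operator
-- τ : 2^E → 2^E is a function Subset n → Subset n.
Operator : ℕ → Set
Operator n = Subset n → Subset n

C1 : ∀ {n} → Operator n → Set
C1 {n} τ = (X : Subset n) → X ⊆ τ X

C22 : ∀ {n} → Operator n → Set
C22 {n} τ = (F G : Subset n) → F ⊆ G → G ⊆ τ F → τ G ≡ τ F

IsViolatorSpace : ∀ {n} → Operator n → Set
IsViolatorSpace τ = C1 τ × C22 τ

IsGenerator : ∀ {n} → Operator n → Subset n → Subset n → Set
IsGenerator τ X B = τ B ≡ τ X

IsBasis : ∀ {n} → Operator n → Subset n → Subset n → Set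
IsBasis {n} τ X B =
  IsGenerator τ X B × ((B′ : Subset n) → B′ ⊂ B → ¬ IsGenerator τ X B′)

UniquelyGenerated : ∀ {n} → Operator n → Set
UniquelyGenerated {n} τ =
  (X : Subset n) → ∃ λ B → IsBasis τ X B × ((B′ : Subset n) → IsBasis τ X B′ → B′ ≡ B)

module Submission where

-- In a uniquely generated space the unique basis B of X
-- is the least generator of X: every generator Z of X contains some basis of
-- X (search downwards along ⊂, which is well-founded since E is finite), and
-- that basis must be B.  So B ⊆ X ∩ Y whenever X and Y generate the same
-- closure.  Now X ∩ Y and X ∪ Y both lie between B and τ X (using (C1) for
-- X and Y), and (C22) says that any set sandwiched between a generator B and
-- its closure τ B is again a generator.

open import Defs
open import Data.Nat using (ℕ)
open import Data.Fin.Subset using (Subset; _∩_; _∪_; _⊆_; _⊂_)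
open import Data.Fin.Subset.Properties
  using (anySubset?; _⊂?_; ⊆-trans; p∩q⊆p; p⊆p∪q; x∈p∩q⁺; x∈p∪q⁻)
open import Data.Fin.Subset.Induction using (⊂-wellFounded; Acc; acc)
open import Data.Product using (_×_; _,_; ∃; proj₁)
open import Data.Sum using ([_,_])
open import Data.Vec.Properties using (≡-dec)
open import Data.Bool.Properties using () renaming (_≟_ to _≟ᴮ_)
open import Relation.Nullary using (Dec; yes; no; _×-dec_)
open import Relation.Binary.PropositionalEquality using (_≡_; refl; sym; trans; subst)

_≟ˢ_ : ∀ {n} (P Q : Subset n) → Dec (P ≡ Q)
_≟ˢ_ = ≡-dec _≟ᴮ_

∪-least : ∀ {n} {P Q R : Subset n} → P ⊆ R → Q ⊆ R → P ∪ Q ⊆ R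
∪-least {P = P} {Q} P⊆R Q⊆R x∈P∪Q = [ P⊆R , Q⊆R ] (x∈p∪q⁻ P Q x∈P∪Q)

∩-greatest : ∀ {n} {P Q R : Subset n} → R ⊆ P → R ⊆ Q → R ⊆ P ∩ Q
∩-greatest R⊆P R⊆Q x∈R = x∈p∩q⁺ (R⊆P x∈R , R⊆Q x∈R)

module _ {n : ℕ} (τ : Operator n) where

  basis-below : (X Z : Subset n) → IsGenerator τ X Z → Acc _⊂_ Z →
                ∃ λ B → B ⊆ Z × IsBasis τ X B
  basis-below X Z Z-gen (acc smaller)
    with anySubset? (λ B′ → (B′ ⊂? Z) ×-dec (τ B′ ≟ˢ τ X))
  ... | no none = Z , (λ x∈Z → x∈Z) , Z-gen , λ B′ B′⊂Z B′-gen → none (B′ , B′⊂Z , B′-gen)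
  ... | yes (B′ , B′⊂Z , B′-gen) with basis-below X B′ B′-gen (smaller B′⊂Z)
  ...   | B , B⊆B′ , B-basis = B , ⊆-trans B⊆B′ (proj₁ B′⊂Z) , B-basis

  basis-inside-generator : (X Z : Subset n) → IsGenerator τ X Z →
                           ∃ λ B → B ⊆ Z × IsBasis τ X B
  basis-inside-generator X Z Z-gen = basis-below X Z Z-gen (⊂-wellFounded Z)

  least-generator : UniquelyGenerated τ → (X : Subset n) →
                    ∃ λ B → IsGenerator τ X B × ((Z : Subset n) → IsGenerator τ X Z → B ⊆ Z)
  least-generator unique X with unique X
  ... | B , (B-gen , _) , B-unique = B , B-gen , B-least
    where
    B-least : (Z : Subset n) → IsGenerator τ X Z → B ⊆ Z
    B-least Z Z-gen with basis-inside-generator X Z Z-gen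
    ... | B′ , B′⊆Z , B′-basis = subst (_⊆ Z) (B-unique B′ B′-basis) B′⊆Z

  generator-⊆-closure : C1 τ → {X Z : Subset n} → IsGenerator τ X Z → Z ⊆ τ X
  generator-⊆-closure extensive {Z = Z} Z-gen = subst (Z ⊆_) Z-gen (extensive Z)

  generator-sandwich : C22 τ → {X B Z : Subset n} → IsGenerator τ X B →
                       B ⊆ Z → Z ⊆ τ X → IsGenerator τ X Z
  generator-sandwich c22 {B = B} {Z} B-gen B⊆Z Z⊆τX =
    trans (c22 B Z B⊆Z (subst (Z ⊆_) (sym B-gen) Z⊆τX)) B-gen

mainTheorem17 : (n : ℕ) (τ : Operator n) → IsViolatorSpace τ → UniquelyGenerated τ →
    (X Y : Subset n) → τ X ≡ τ Y → (τ (X ∩ Y) ≡ τ X) × (τ (X ∪ Y) ≡ τ X)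
mainTheorem17 n τ (c1 , c22) unique X Y τX≡τY with least-generator τ unique X
... | B , B-gen , B-least = intersection-generates , union-generates
  where
  Y-gen : IsGenerator τ X Y
  Y-gen = sym τX≡τY

  B⊆X : B ⊆ X
  B⊆X = B-least X refl

  intersection-generates : τ (X ∩ Y) ≡ τ X
  intersection-generates =
    generator-sandwich τ c22 B-gen (∩-greatest B⊆X (B-least Y Y-gen))
                                   (⊆-trans (p∩q⊆p X Y) (c1 X))

  union-generates : τ (X ∪ Y) ≡ τ X
  union-generates =
    generator-sandwich τ c22 B-gen (⊆-trans B⊆X (p⊆p∪q Y))
                                   (∪-least (c1 X) (generator-⊆-closure τ c1 Y-gen))
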